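{- Let $k,l\in\mathbb{N}$. Suppose $T$ is a tree containing a vertex $t$, and $Q\subset V(T)$ with $|Q|=l$ is $2k$-separated in $T$. Then there is a sequence $T_1,\dots,T_l$ of subtrees of $T$ such that $t\in V(T_1)$ and, for each $1<i\le l$, $T_i$ is obtained from $T_{i-1}$ by adding a bare path of length at least $k$ (a path of length at least $k$ meeting $T_{i-1}$ in exactly one of its endvertices, all its other vertices being new) whose other endvertex is a vertex of $Q$, which becomes a leaf of $T_i$.
   Context: A set $Q$ is $2k$-separated in $T$ if every two distinct vertices of $Q$ are at distance at least $2k$ in $T$. The length of a path is its number of edges. -}

module Defs where

open import Data.Nat using (ℕ; zero; suc; _≤_)
open import Data.Fin using (Fin)
open import Data.Fin.Subset using (Subset; _∈_; _∉_)
open import Data.List using (List; []; _∷_)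
import Data.List.Membership.Propositional as L
open import Data.List.Relation.Unary.Unique.Propositional using (Unique)
open import Data.Product using (Σ; ∃; _×_; _,_)
open import Data.Sum using (_⊎_)
open import Relation.Binary.PropositionalEquality using (_≡_)
open import Relation.Nullary using (¬_)
open import Function.Bundles using (_⇔_)

record Graph : Set₁ where
  field
    n     : ℕ
    Adj   : Fin n → Fin n → Set
    sym   : ∀ {u v} → Adj u v → Adj v u
    irrefl : ∀ {u} → ¬ Adj u u

open Graph public

module _ (G : Graph) where

  V : Set
  V = Fin (n G)

  data Walk : V → V → ℕ → Set where
    [] : ∀ {u} → Walk u u 0
    _∷_ : ∀ {u w v m} → Adj G u w → Walk w v m → Walk u (v) (suc m)

  verts : ∀ {u v m} → Walk u v m → List V
  verts {u} [] = u ∷ []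
  verts {u} (_ ∷ p) = u ∷ verts p

  -- vertices of a walk other than its first vertex
  innerTail : ∀ {u v m} → Walk u v m → List V
  innerTail [] = []
  innerTail (_ ∷ p) = verts p

  IsPath : ∀ {u v m} → Walk u v m → Set
  IsPath p = Unique (verts p)

  Connected : Set
  Connected = ∀ (u v : V) → ∃ λ m → Walk u v m

  HasCycle : Set
  HasCycle = Σ V λ u → Σ V λ v → Σ ℕ λ m → Σ (Walk u v m) λ p →
             IsPath p × 2 ≤ m × Adj G v u

  IsTree : Set
  IsTree = Connected × ¬ HasCycle

  DistAtLeast : ℕ → V → V → Set
  DistAtLeast d u v = ∀ {m} → Walk u v m → d ≤ m

  Separated : ℕ → Subset (n G) → Set
  Separated d Q = ∀ u v → u ∈ Q → v ∈ Q → ¬ u ≡ v → DistAtLeast d u v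

  -- a subtree (of a tree), given by its vertex set: nonempty and connected
  -- in the subgraph induced on it (in a tree, a connected subgraph is induced)
  IsSubtree : Subset (n G) → Set
  IsSubtree S = (∃ λ x → x ∈ S) ×
    (∀ u v → u ∈ S → v ∈ S →
       Σ ℕ λ m → Σ (Walk u v m) λ p → ∀ x → x L.∈ verts p → x ∈ S)

  IsLeaf : Subset (n G) → V → Set
  IsLeaf S v = v ∈ S × (Σ V λ w → w ∈ S × Adj G v w ×
                          (∀ w' → w' ∈ S → Adj G v w' → w' ≡ w))

  BarePathExt : ℕ → Subset (n G) → Subset (n G) → Subset (n G) → Set
  BarePathExt k Q S S' =
    Σ V λ u → Σ V λ v → Σ ℕ λ m → Σ (Walk u v m) λ p →
      IsPath p × k ≤ m × u ∈ S ×
      (∀ x → x L.∈ innerTail p → x ∉ S) ×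
      v ∈ Q ×
      (∀ x → (x ∈ S') ⇔ (x ∈ S ⊎ x L.∈ verts p)) ×
      IsLeaf S' v

-- Grow the tree greedily from t: attach a shortest path from the current tree S to the
-- nearest vertex q of Q outside S. By minimality the path meets S only in its first vertex y,
-- passes through no other vertex of Q outside S, and ends in a leaf q. Its length is at least k
-- thanks to the invariant that every vertex of S is at least as close to Q ∩ S as to Q ─ S:
-- if q′ ∈ Q ∩ S is nearest to y, separation gives 2k ≤ d(q, q′) ≤ d(y, q) + d(y, q′) ≤ 2 d(y, q).
-- Each step adds exactly one vertex of Q, so starting from {t} (or, when t ∉ Q, from a shortest
-- path from t into Q) one obtains exactly ∣Q∣ trees.
module Submission where

open import Defs
open import Data.Empty using (⊥-elim)
open import Data.Fin using (Fin; toℕ; zero; suc) renaming (_≟_ to _≟ᶠ_)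
open import Data.Fin.Properties using (any?; toℕ<n)
open import Data.Fin.Subset
  using (Subset; _∈_; _∉_; _⊆_; ∣_∣; inside; outside; ⁅_⁆; _∪_; _─_; _-_; Nonempty)
open import Data.Fin.Subset.Properties
  using (_∈?_; p─⊥≡p; p─q⊆p; x∈p∧x∉q⇒x∈p─q; ⊆-antisym; x≢y⇒x∉⁅y⁆; x∉⁅y⁆⇒x≢y; x∈p∪q⁺; x∈p∪q⁻;
         x∈⁅x⁆; x∈⁅y⁆⇒x≡y; nonempty?; Empty-unique; ∣⊥∣≡0; ∉⊥)
import Data.Fin.Subset as Sub
open import Data.List using (List; []; _∷_)
open import Data.List.Membership.Propositional using () renaming (_∈_ to _∈ₗ_)
open import Data.List.Relation.Unary.Any using (here; there)
open import Data.List.Relation.Unary.All.Properties using (¬Any⇒All¬)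
import Data.List.Membership.DecPropositional as DecMembership
open import Data.List.Relation.Unary.Unique.Propositional using (Unique)
open import Data.List.Relation.Unary.AllPairs using ([]; _∷_)
open import Data.List.Relation.Unary.All using ([])
open import Data.List.Relation.Binary.Subset.Propositional using () renaming (_⊆_ to _⊆ₗ_)
open import Data.Nat using (ℕ; zero; suc; _+_; _*_; _≤_; _<_; z≤n; s≤s; z<s)
open import Data.Nat.Properties
  using (m<1+n⇒m<n∨m≡n; n<1+n; 0≢1+n; m≤n+m; m<m+n; ≤-trans; m≤n⇒m≤1+n; <⇒≱; ≮⇒≥; ≤-pred;
         +-cancelˡ-≤; suc-injective; *-cancelˡ-≤; +-monoʳ-≤; +-identityʳ; module ≤-Reasoning)
open import Data.Product using (Σ; _×_; _,_; proj₁; proj₂)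
open import Data.Sum using (_⊎_; inj₁; inj₂; [_,_]′)
import Data.Sum as Sum
import Data.Vec.Base as Vec
open import Data.Vec.Base using (_∷_)
open import Function.Base using (id; _∘_)
open import Function.Bundles using (_⇔_; mk⇔)
open import Relation.Binary.PropositionalEquality
  using (_≡_; refl; cong; trans; subst) renaming (sym to ≡-sym)
open import Relation.Nullary using (¬_; Dec; yes; no; contradiction)
open import Relation.Nullary.Decidable using (_×-dec_)
open import Relation.Unary using (Decidable)

Least : (ℕ → Set) → ℕ → Set
Least P k = P k × (∀ {j} → j < k → ¬ P j)

least-below : {P : ℕ → Set} → Decidable P → ∀ b → (Σ ℕ (Least P)) ⊎ (∀ {j} → j < b → ¬ P j)
least-below P? zero = inj₂ λ ()
least-below P? (suc b) with least-below P? b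
... | inj₁ found = inj₁ found
... | inj₂ none with P? b
...   | yes Pb = inj₁ (b , Pb , none)
...   | no ¬Pb = inj₂ λ j<1+b → [ none , (λ { refl → ¬Pb }) ]′ (m<1+n⇒m<n∨m≡n j<1+b)

least-witness : {P : ℕ → Set} → Decidable P → ∀ {m} → P m → Σ ℕ (Least P)
least-witness P? {m} Pm with least-below P? (suc m)
... | inj₁ found = found
... | inj₂ none = ⊥-elim (none (n<1+n m) Pm)

x∈p─q⇒x∉q : ∀ {n} {x : Fin n} (p q : Subset n) → x ∈ p ─ q → x ∉ q
x∈p─q⇒x∉q (_ ∷ _) (outside ∷ _) Vec.here = λ ()
x∈p─q⇒x∉q (_ ∷ p) (_ ∷ q) (Vec.there x∈p─q) (Vec.there x∈q) = x∈p─q⇒x∉q p q x∈p─q x∈q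

x∈p⇒∣p∣≡1+∣p-x∣ : ∀ {n} {x : Fin n} {p : Subset n} → x ∈ p → ∣ p ∣ ≡ suc ∣ p - x ∣
x∈p⇒∣p∣≡1+∣p-x∣ {p = inside ∷ p} Vec.here = cong (λ r → suc ∣ r ∣) (≡-sym (p─⊥≡p p))
x∈p⇒∣p∣≡1+∣p-x∣ {p = inside ∷ p} (Vec.there x∈p) = cong suc (x∈p⇒∣p∣≡1+∣p-x∣ x∈p)
x∈p⇒∣p∣≡1+∣p-x∣ {p = outside ∷ p} (Vec.there x∈p) = x∈p⇒∣p∣≡1+∣p-x∣ x∈p

∣p∣≡1+r⇒Nonempty : ∀ {n r} (p : Subset n) → ∣ p ∣ ≡ suc r → Nonempty p
∣p∣≡1+r⇒Nonempty {n} p ∣p∣≡1+r with nonempty? p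
... | yes ne = ne
... | no empty = contradiction
  (trans (≡-sym (∣⊥∣≡0 n)) (trans (cong ∣_∣ (≡-sym (Empty-unique empty))) ∣p∣≡1+r)) 0≢1+n

─-antimonoʳ-⊆ : ∀ {n} {p q r : Subset n} → q ⊆ r → p ─ r ⊆ p ─ q
─-antimonoʳ-⊆ {p = p} {r = r} q⊆r x∈ = x∈p∧x∉q⇒x∈p─q (p─q⊆p p r x∈) (x∈p─q⇒x∉q p r x∈ ∘ q⊆r)

x∉p⇒p-x≡p : ∀ {n} {x : Fin n} {p : Subset n} → x ∉ p → p - x ≡ p
x∉p⇒p-x≡p {x = x} {p} x∉p = ⊆-antisym (p─q⊆p p ⁅ x ⁆)
  λ y∈p → x∈p∧x∉q⇒x∈p─q y∈p λ y∈⁅x⁆ → x∉p (subst (_∈ p) (x∈⁅y⁆⇒x≡y x y∈⁅x⁆) y∈p)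

fromList : ∀ {n} → List (Fin n) → Subset n
fromList [] = Sub.⊥
fromList (x ∷ xs) = ⁅ x ⁆ ∪ fromList xs

∈-fromList⁺ : ∀ {n} {x : Fin n} {xs} → x ∈ₗ xs → x ∈ fromList xs
∈-fromList⁺ (here refl) = x∈p∪q⁺ (inj₁ (x∈⁅x⁆ _))
∈-fromList⁺ (there x∈xs) = x∈p∪q⁺ (inj₂ (∈-fromList⁺ x∈xs))

∈-fromList⁻ : ∀ {n} {x : Fin n} xs → x ∈ fromList xs → x ∈ₗ xs
∈-fromList⁻ [] x∈⊥ = contradiction x∈⊥ ∉⊥
∈-fromList⁻ (y ∷ xs) x∈ with x∈p∪q⁻ ⁅ y ⁆ (fromList xs) x∈
... | inj₁ x∈⁅y⁆ = here (x∈⁅y⁆⇒x≡y y x∈⁅y⁆)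
... | inj₂ x∈xs = there (∈-fromList⁻ xs x∈xs)

module _ {G : Graph} where

  head∈verts : ∀ {u v m} (p : Walk G u v m) → u ∈ₗ verts G p
  head∈verts []      = here refl
  head∈verts (_ ∷ _) = here refl

  last∈verts : ∀ {u v m} (p : Walk G u v m) → v ∈ₗ verts G p
  last∈verts []      = here refl
  last∈verts (_ ∷ p) = there (last∈verts p)

  length≤0⇒≡ : ∀ {u v m} → Walk G u v m → m ≤ 0 → u ≡ v
  length≤0⇒≡ [] _ = refl

  _++ʷ_ : ∀ {u v w m m′} → Walk G u v m → Walk G v w m′ → Walk G u w (m + m′)
  []      ++ʷ q = q
  (e ∷ p) ++ʷ q = e ∷ (p ++ʷ q)

  ∈-verts-++⁻ : ∀ {u v w m m′ x} (p : Walk G u v m) (q : Walk G v w m′) →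
    x ∈ₗ verts G (p ++ʷ q) → x ∈ₗ verts G p ⊎ x ∈ₗ verts G q
  ∈-verts-++⁻ []      q x∈        = inj₂ x∈
  ∈-verts-++⁻ (e ∷ p) q (here refl) = inj₁ (here refl)
  ∈-verts-++⁻ (e ∷ p) q (there x∈) = Sum.map₁ there (∈-verts-++⁻ p q x∈)

  _∷ʳ_ : ∀ {u v w m} → Walk G u v m → Adj G v w → Walk G u w (suc m)
  []       ∷ʳ e = e ∷ []
  (e′ ∷ p) ∷ʳ e = e′ ∷ (p ∷ʳ e)

  ∈-verts-∷ʳ⁺ : ∀ {u v w m x} (p : Walk G u v m) (e : Adj G v w) →
    x ∈ₗ verts G p → x ∈ₗ verts G (p ∷ʳ e)
  ∈-verts-∷ʳ⁺ []       e (here refl) = here refl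
  ∈-verts-∷ʳ⁺ (e′ ∷ p) e (here refl) = here refl
  ∈-verts-∷ʳ⁺ (e′ ∷ p) e (there x∈) = there (∈-verts-∷ʳ⁺ p e x∈)

  ∈-verts-∷ʳ⁻ : ∀ {u v w m x} (p : Walk G u v m) (e : Adj G v w) →
    x ∈ₗ verts G (p ∷ʳ e) → x ∈ₗ verts G p ⊎ x ≡ w
  ∈-verts-∷ʳ⁻ []       e (here refl)         = inj₁ (here refl)
  ∈-verts-∷ʳ⁻ []       e (there (here refl)) = inj₂ refl
  ∈-verts-∷ʳ⁻ (e′ ∷ p) e (here refl)         = inj₁ (here refl)
  ∈-verts-∷ʳ⁻ (e′ ∷ p) e (there x∈)          = Sum.map₁ there (∈-verts-∷ʳ⁻ p e x∈)

  data UnsnocView {u v m} : Walk G u v (suc m) → Set where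
    _∷ʳ′_ : ∀ {w} (p : Walk G u w m) (e : Adj G w v) → UnsnocView (p ∷ʳ e)

  unsnoc : ∀ {u v m} (p : Walk G u v (suc m)) → UnsnocView p
  unsnoc (e ∷ []) = [] ∷ʳ′ e
  unsnoc (e ∷ p@(_ ∷ _)) with p | unsnoc p
  ... | .(p₀ ∷ʳ e′) | p₀ ∷ʳ′ e′ = (e ∷ p₀) ∷ʳ′ e′

  reverse : ∀ {u v m} → Walk G u v m → Walk G v u m
  reverse []      = []
  reverse (e ∷ p) = reverse p ∷ʳ Graph.sym G e

  ∈-verts-reverse⁻ : ∀ {u v m x} (p : Walk G u v m) → x ∈ₗ verts G (reverse p) → x ∈ₗ verts G p
  ∈-verts-reverse⁻ []      x∈ = x∈
  ∈-verts-reverse⁻ (e ∷ p) x∈ with ∈-verts-∷ʳ⁻ (reverse p) (Graph.sym G e) x∈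
  ... | inj₁ x∈rev = there (∈-verts-reverse⁻ p x∈rev)
  ... | inj₂ refl  = here refl

  record SplitAt {u v m} (p : Walk G u v m) (x : V G) : Set where
    field
      j L        : ℕ
      prefix     : Walk G u x j
      suffix     : Walk G x v L
      length-sum : j + L ≡ m
      prefix⊆    : verts G prefix ⊆ₗ verts G p
      suffix⊆    : verts G suffix ⊆ₗ verts G p
      suffix-unique : Unique (verts G p) → Unique (verts G suffix)

  splitAt : ∀ {u v m x} (p : Walk G u v m) → x ∈ₗ verts G p → SplitAt p x
  splitAt []      (here refl) = record
    { prefix = [] ; suffix = [] ; length-sum = refl
    ; prefix⊆ = id ; suffix⊆ = id ; suffix-unique = id }
  splitAt (e ∷ p) (here refl) = record
    { prefix = [] ; suffix = e ∷ p ; length-sum = refl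
    ; prefix⊆ = λ { (here refl) → here refl } ; suffix⊆ = id ; suffix-unique = id }
  splitAt (e ∷ p) (there x∈) = record
    { prefix = e ∷ prefix ; suffix = suffix ; length-sum = cong suc length-sum
    ; prefix⊆ = λ { (here refl) → here refl ; (there y∈) → there (prefix⊆ y∈) }
    ; suffix⊆ = there ∘ suffix⊆
    ; suffix-unique = λ { (_ ∷ uniq) → suffix-unique uniq } }
    where open SplitAt (splitAt p x∈)

  module _ {u v m x} {p : Walk G u v m} (s : SplitAt p x) where
    open SplitAt s

    suffix-length≤ : L ≤ m
    suffix-length≤ = subst (L ≤_) length-sum (m≤n+m L j)

    prefix-length< : ¬ x ≡ v → j < m
    prefix-length< x≢v with L | suffix | length-sum
    ... | zero  | suffix₀ | _    = contradiction (length≤0⇒≡ suffix₀ z≤n) x≢v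
    ... | suc L′ | _      | j+L≡m = subst (j <_) j+L≡m (m<m+n j z<s)

  suffix-from-inner : ∀ {u v m x} (p : Walk G u v m) → x ∈ₗ innerTail G p →
    Σ ℕ λ L → Walk G x v L × L < m
  suffix-from-inner (e ∷ p) x∈ = L , suffix , s≤s (suffix-length≤ s)
    where
    s : SplitAt p _
    s = splitAt p x∈
    open SplitAt s

  open DecMembership (_≟ᶠ_ {n G}) using () renaming (_∈?_ to _∈ₗ?_)

  record PathWithin {u v m} (p : Walk G u v m) : Set where
    field
      len    : ℕ
      path   : Walk G u v len
      isPath : IsPath G path
      len≤   : len ≤ m
      verts⊆ : verts G path ⊆ₗ verts G p

  toPath : ∀ {u v m} (p : Walk G u v m) → PathWithin p
  toPath [] = record { path = [] ; isPath = [] ∷ [] ; len≤ = z≤n ; verts⊆ = id }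
  toPath {u} (e ∷ p) with toPath p
  ... | r with u ∈ₗ? verts G (PathWithin.path r)
  ...   | yes u∈ = record
    { path = suffix ; isPath = suffix-unique isPath
    ; len≤ = m≤n⇒m≤1+n (≤-trans (suffix-length≤ s) len≤)
    ; verts⊆ = there ∘ verts⊆ ∘ suffix⊆ }
    where
    open PathWithin r
    s : SplitAt path u
    s = splitAt path u∈
    open SplitAt s
  ...   | no u∉ = record
    { path = e ∷ path ; isPath = ¬Any⇒All¬ _ u∉ ∷ isPath ; len≤ = s≤s len≤
    ; verts⊆ = λ { (here refl) → here refl ; (there x∈) → there (verts⊆ x∈) } }
    where open PathWithin r

  WalkIn : Subset (n G) → V G → V G → Set
  WalkIn S u v = Σ ℕ λ m → Σ (Walk G u v m) λ p → ∀ x → x ∈ₗ verts G p → x ∈ S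

  WalkIn-reverse : ∀ {S u v} → WalkIn S u v → WalkIn S v u
  WalkIn-reverse (m , p , p⊆S) = m , reverse p , λ x → p⊆S x ∘ ∈-verts-reverse⁻ p

  WalkIn-++ : ∀ {S u v w} → WalkIn S u v → WalkIn S v w → WalkIn S u w
  WalkIn-++ (m , p , p⊆S) (m′ , q , q⊆S) =
    m + m′ , p ++ʷ q , λ x x∈ → [ p⊆S x , q⊆S x ]′ (∈-verts-++⁻ p q x∈)

  WalkIn-mono : ∀ {S S′ u v} → S ⊆ S′ → WalkIn S u v → WalkIn S′ u v
  WalkIn-mono S⊆S′ (m , p , p⊆S) = m , p , λ x → S⊆S′ ∘ p⊆S x

  IsSubtree-⁅⁆ : ∀ x → IsSubtree G ⁅ x ⁆
  IsSubtree-⁅⁆ x = (x , x∈⁅x⁆ x) , λ u v u∈ v∈ → trivial (x∈⁅y⁆⇒x≡y x u∈) (x∈⁅y⁆⇒x≡y x v∈)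
    where
    trivial : ∀ {u v} → u ≡ x → v ≡ x → WalkIn ⁅ x ⁆ u v
    trivial refl refl = 0 , [] , λ { _ (here refl) → x∈⁅x⁆ x }

  _∪ʷ_ : ∀ {u v m} → Subset (n G) → Walk G u v m → Subset (n G)
  S ∪ʷ p = S ∪ fromList (verts G p)

  module _ {S : Subset (n G)} {u v m} (p : Walk G u v m) where

    ∈-∪ʷ⁺ˡ : ∀ {x} → x ∈ S → x ∈ S ∪ʷ p
    ∈-∪ʷ⁺ˡ = x∈p∪q⁺ ∘ inj₁

    ∈-∪ʷ⁺ʳ : ∀ {x} → x ∈ₗ verts G p → x ∈ S ∪ʷ p
    ∈-∪ʷ⁺ʳ = x∈p∪q⁺ ∘ inj₂ ∘ ∈-fromList⁺

    ∈-∪ʷ⁻ : ∀ {x} → x ∈ S ∪ʷ p → x ∈ S ⊎ x ∈ₗ verts G p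
    ∈-∪ʷ⁻ = Sum.map₂ (∈-fromList⁻ _) ∘ x∈p∪q⁻ S _

    ∈-∪ʷ⇔ : ∀ {x} → x ∈ S ∪ʷ p ⇔ (x ∈ S ⊎ x ∈ₗ verts G p)
    ∈-∪ʷ⇔ = mk⇔ ∈-∪ʷ⁻ [ ∈-∪ʷ⁺ˡ , ∈-∪ʷ⁺ʳ ]′

  IsSubtree-∪ʷ : ∀ {S y v m} → IsSubtree G S → y ∈ S → (p : Walk G y v m) → IsSubtree G (S ∪ʷ p)
  IsSubtree-∪ʷ {S} {y} (_ , connected) y∈S p = (y , ∈-∪ʷ⁺ˡ p y∈S) , λ u w u∈ w∈ →
    WalkIn-++ (WalkIn-reverse (from-y u∈)) (from-y w∈)
    where
    from-y : ∀ {u} → u ∈ S ∪ʷ p → WalkIn (S ∪ʷ p) y u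
    from-y {u} u∈ with ∈-∪ʷ⁻ p u∈
    ... | inj₁ u∈S = WalkIn-mono (∈-∪ʷ⁺ˡ p) (connected y u y∈S u∈S)
    ... | inj₂ u∈p = j , prefix , λ x → ∈-∪ʷ⁺ʳ p ∘ prefix⊆
      where open SplitAt (splitAt p u∈p)

module _ {G : Graph} where

  -- Adjacency is not assumed decidable; in a tree it is read off the length of a u–v path.
  adjacent? : IsTree G → ∀ u v → Dec (Adj G u v)
  adjacent? (connected , acyclic) u v with toPath (proj₂ (connected u v))
  ... | record { len = zero ; path = p } =
    no λ uv → Graph.irrefl G (subst (Adj G u) (≡-sym (length≤0⇒≡ p z≤n)) uv)
  ... | record { len = suc zero ; path = e ∷ [] } = yes e
  ... | record { len = suc (suc m) ; path = p ; isPath = isPath } =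
    no λ uv → acyclic (u , v , suc (suc m) , p , isPath , s≤s (s≤s z≤n) , Graph.sym G uv)

  walk? : IsTree G → ∀ m u v → Dec (Walk G u v m)
  walk? tree zero u v with u ≟ᶠ v
  ... | yes refl = yes []
  ... | no u≢v = no λ { [] → u≢v refl }
  walk? tree (suc m) u v with any? (λ w → adjacent? tree u w ×-dec walk? tree m w v)
  ... | yes (w , e , p) = yes (e ∷ p)
  ... | no ∄w = no λ { (e ∷ p) → ∄w (_ , e , p) }

  neighbours-in-subtree-≡ : ¬ HasCycle G → ∀ {S q a b} → IsSubtree G S → q ∉ S → a ∈ S → b ∈ S →
    Adj G q a → Adj G q b → a ≡ b
  neighbours-in-subtree-≡ acyclic {S} {q} {a} {b} (_ , connected) q∉S a∈S b∈S qa qb with a ≟ᶠ b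
  ... | yes a≡b = a≡b
  ... | no a≢b = ⊥-elim (acyclic (q , b , suc len , qa ∷ path ,
          ¬Any⇒All¬ _ (q∉S ∘ p⊆S q ∘ verts⊆) ∷ isPath , s≤s (length>0 path) , Graph.sym G qb))
    where
    ab : WalkIn S a b
    ab = connected a b a∈S b∈S
    open PathWithin (toPath (proj₁ (proj₂ ab)))
    p⊆S : ∀ x → x ∈ₗ verts G (proj₁ (proj₂ ab)) → x ∈ S
    p⊆S = proj₂ (proj₂ ab)
    length>0 : ∀ {m} → Walk G a b m → 1 ≤ m
    length>0 []      = contradiction refl a≢b
    length>0 (_ ∷ _) = s≤s z≤n

SetDistAtLeast : (G : Graph) → ℕ → Subset (n G) → Subset (n G) → Set
SetDistAtLeast G d A B = ∀ {a b} → a ∈ A → b ∈ B → DistAtLeast G d a b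

module NearestWalk {G : Graph} {S U : Subset (n G)} {y q m} (P : Walk G y q m)
  (y∈S : y ∈ S) (q∈U : q ∈ U) (nearest : SetDistAtLeast G m S U) where

  inner∉ : ∀ {x} → x ∈ₗ innerTail G P → x ∉ S
  inner∉ x∈ x∈S with suffix-from-inner P x∈
  ... | L , x→q , L<m = <⇒≱ L<m (nearest x∈S q∈U x→q)

  earlier∉ : ∀ {x} → x ∈ₗ verts G P → ¬ x ≡ q → x ∉ U
  earlier∉ {x} x∈ x≢q x∈U = <⇒≱ (prefix-length< s x≢q) (nearest y∈S x∈U (SplitAt.prefix s))
    where
    s : SplitAt P x
    s = splitAt P x∈

  suffix-nearest : ∀ {x} → x ∈ₗ verts G P →
    Σ ℕ λ L → Walk G x q L × (∀ {u} → u ∈ U → DistAtLeast G L x u)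
  suffix-nearest x∈ = L , suffix , λ u∈U x→u →
    +-cancelˡ-≤ j L _ (subst (_≤ j + _) (≡-sym length-sum) (nearest y∈S u∈U (prefix ++ʷ x→u)))
    where open SplitAt (splitAt P x∈)

nearest-end-isLeaf : ∀ {G : Graph} {S U : Subset (n G)} {y q m} → ¬ HasCycle G → IsSubtree G S →
  y ∈ S → q ∉ S → q ∈ U → SetDistAtLeast G m S U → (P : Walk G y q m) → IsLeaf G (S ∪ʷ P) q
nearest-end-isLeaf {S = S} {m = zero} _ _ y∈S q∉S _ _ P =
  contradiction (subst (_∈ S) (length≤0⇒≡ P z≤n) y∈S) q∉S
nearest-end-isLeaf {G} {S} {q = q} {suc _} acyclic sub y∈S q∉S q∈U nearest P with P | unsnoc P
... | .(p₀ ∷ʳ e) | _∷ʳ′_ {w} p₀ e =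
  ∈-∪ʷ⁺ʳ (p₀ ∷ʳ e) (last∈verts (p₀ ∷ʳ e)) ,
  w , ∈-∪ʷ⁺ʳ (p₀ ∷ʳ e) (∈-verts-∷ʳ⁺ p₀ e (last∈verts p₀)) , Graph.sym G e , only-w
  where
  only-w : ∀ w′ → w′ ∈ S ∪ʷ (p₀ ∷ʳ e) → Adj G q w′ → w′ ≡ w
  only-w w′ w′∈ qw′ with ∈-∪ʷ⁻ (p₀ ∷ʳ e) w′∈
  ... | inj₁ w′∈S = neighbours-in-subtree-≡ acyclic sub q∉S w′∈S w∈S qw′ (Graph.sym G e)
    where
    w∈S : w ∈ S
    w∈S = subst (_∈ S) (length≤0⇒≡ p₀ (≤-pred (nearest w′∈S q∈U (Graph.sym G qw′ ∷ [])))) y∈S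
  ... | inj₂ w′∈P with ∈-verts-∷ʳ⁻ p₀ e w′∈P
  ...   | inj₂ refl = contradiction qw′ (Graph.irrefl G)
  ...   | inj₁ w′∈p₀ with w′ ≟ᶠ w
  ...     | yes w′≡w = w′≡w
  ...     | no w′≢w = contradiction (nearest y∈S q∈U (prefix ∷ʳ Graph.sym G qw′))
                                    (<⇒≱ (s≤s (prefix-length< s w′≢w)))
    where
    s : SplitAt p₀ w′
    s = splitAt p₀ w′∈p₀
    open SplitAt s

module Greedy (G : Graph) (tree : IsTree G) (k : ℕ) (Q : Subset (n G))
  (separated : Separated G (2 * k) Q) where

  Anchored : Subset (n G) → V G → Set
  Anchored S x = Σ (V G) λ a → a ∈ Q × a ∈ S × Σ ℕ λ L → Walk G x a L ×
    (∀ {u} → u ∈ Q ─ S → DistAtLeast G L x u)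

  Anchored-mono : ∀ {S S′ x} → S ⊆ S′ → Anchored S x → Anchored S′ x
  Anchored-mono S⊆S′ (a , a∈Q , a∈S , L , x→a , nearer) =
    a , a∈Q , S⊆S′ a∈S , L , x→a , nearer ∘ ─-antimonoʳ-⊆ S⊆S′

  record NearestPath (S : Subset (n G)) : Set where
    field
      y q     : V G
      m       : ℕ
      path    : Walk G y q m
      isPath  : IsPath G path
      y∈S     : y ∈ S
      q∈Q─S   : q ∈ Q ─ S
      nearest : SetDistAtLeast G m S (Q ─ S)

  WalkOut : Subset (n G) → ℕ → Set
  WalkOut S m = Σ (V G) λ x → x ∈ S × Σ (V G) λ u → u ∈ Q ─ S × Walk G x u m

  walkOut? : ∀ S → Decidable (WalkOut S)
  walkOut? S m = any? λ x → (x ∈? S) ×-dec any? λ u → (u ∈? Q ─ S) ×-dec walk? tree m x u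

  nearestPath : ∀ {S} → IsSubtree G S → Nonempty (Q ─ S) → NearestPath S
  nearestPath {S} ((x , x∈S) , _) (u , u∈Q─S)
    with least-witness (walkOut? S) (x , x∈S , u , u∈Q─S , proj₂ (proj₁ tree x u))
  ... | _ , (y , y∈S , q , q∈Q─S , y→q) , none = record
    { path = path ; isPath = isPath ; y∈S = y∈S ; q∈Q─S = q∈Q─S
    ; nearest = λ a∈S b∈Q─S a→b →
        ≤-trans len≤ (≮⇒≥ λ shorter → none shorter (_ , a∈S , _ , b∈Q─S , a→b)) }
    where open PathWithin (toPath y→q)

  module Extend {S : Subset (n G)} (subtree : IsSubtree G S) (np : NearestPath S) where
    open NearestPath np public

    S′ : Subset (n G)
    S′ = S ∪ʷ path

    S⊆S′ : S ⊆ S′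
    S⊆S′ = ∈-∪ʷ⁺ˡ path

    q∈Q : q ∈ Q
    q∈Q = p─q⊆p Q S q∈Q─S

    q∉S : q ∉ S
    q∉S = x∈p─q⇒x∉q Q S q∈Q─S

    q∈S′ : q ∈ S′
    q∈S′ = ∈-∪ʷ⁺ʳ path (last∈verts path)

    open NearestWalk path y∈S q∈Q─S nearest

    S′-subtree : IsSubtree G S′
    S′-subtree = IsSubtree-∪ʷ subtree y∈S path

    Q─S′≡[Q─S]-q : Q ─ S′ ≡ (Q ─ S) - q
    Q─S′≡[Q─S]-q = ⊆-antisym ⊆-out ⊆-in
      where
      ⊆-out : Q ─ S′ ⊆ (Q ─ S) - q
      ⊆-out x∈ = x∈p∧x∉q⇒x∈p─q (─-antimonoʳ-⊆ S⊆S′ x∈)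
        (x≢y⇒x∉⁅y⁆ λ { refl → x∈p─q⇒x∉q Q S′ x∈ q∈S′ })
      ⊆-in : (Q ─ S) - q ⊆ Q ─ S′
      ⊆-in {x} x∈ = x∈p∧x∉q⇒x∈p─q (p─q⊆p Q S x∈Q─S)
        (([ x∈p─q⇒x∉q Q S x∈Q─S , (λ x∈P → earlier∉ x∈P x≢q x∈Q─S) ]′) ∘ ∈-∪ʷ⁻ path)
        where
        x∈Q─S : x ∈ Q ─ S
        x∈Q─S = p─q⊆p (Q ─ S) ⁅ q ⁆ x∈
        x≢q : ¬ x ≡ q
        x≢q = x∉⁅y⁆⇒x≢y (x∈p─q⇒x∉q (Q ─ S) ⁅ q ⁆ x∈)

    count : ∣ Q ─ S ∣ ≡ suc ∣ Q ─ S′ ∣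
    count = trans (x∈p⇒∣p∣≡1+∣p-x∣ q∈Q─S) (cong (suc ∘ ∣_∣) (≡-sym Q─S′≡[Q─S]-q))

    path-anchored : ∀ {x} → x ∈ₗ verts G path → Anchored S′ x
    path-anchored x∈ with suffix-nearest x∈
    ... | L , x→q , nearer = q , q∈Q , q∈S′ , L , x→q , nearer ∘ ─-antimonoʳ-⊆ S⊆S′

    k≤m : Anchored S y → k ≤ m
    k≤m (a , a∈Q , a∈S , L , y→a , nearer) = *-cancelˡ-≤ 2 (begin
      2 * k        ≤⟨ separated q a q∈Q a∈Q (λ { refl → q∉S a∈S }) (reverse path ++ʷ y→a) ⟩
      m + L        ≤⟨ +-monoʳ-≤ m (nearer q∈Q─S path) ⟩
      m + m        ≡⟨ cong (m +_) (≡-sym (+-identityʳ m)) ⟩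
      2 * m        ∎)
      where open ≤-Reasoning

    bare-extension : Anchored S y → BarePathExt G k Q S S′
    bare-extension anchored =
      y , q , m , path , isPath , k≤m anchored , y∈S , (λ _ → inner∉) , q∈Q , (λ _ → ∈-∪ʷ⇔ path) ,
      nearest-end-isLeaf (proj₂ tree) subtree y∈S q∉S q∈Q─S nearest path

  Invariant : V G → Subset (n G) → Set
  Invariant t S = IsSubtree G S × t ∈ S × (∀ {x} → x ∈ S → Anchored S x)

  extend-invariant : ∀ {t S} (inv : Invariant t S) (np : NearestPath S) →
    Invariant t (Extend.S′ (proj₁ inv) np)
  extend-invariant (subtree , t∈S , anchored) np =
    S′-subtree , S⊆S′ t∈S ,
    λ x∈S′ → [ Anchored-mono S⊆S′ ∘ anchored , path-anchored ]′ (∈-∪ʷ⁻ path x∈S′)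
    where open Extend subtree np

  record Growth (t : V G) (r : ℕ) (S : Subset (n G)) : Set where
    field
      trees     : ℕ → Subset (n G)
      trees-0   : trees 0 ≡ S
      invariant : ∀ i → Invariant t (trees i)
      grows     : ∀ {i} → i < r → BarePathExt G k Q (trees i) (trees (suc i))

  grow : ∀ {t} r {S} → Invariant t S → ∣ Q ─ S ∣ ≡ r → Growth t r S
  grow zero {S} inv _ = record
    { trees = λ _ → S ; trees-0 = refl ; invariant = λ _ → inv ; grows = λ () }
  grow (suc r) {S} inv@(subtree , _ , anchored) ∣Q─S∣≡1+r = record
    { trees     = λ { zero → S ; (suc i) → trees i }
    ; trees-0   = refl
    ; invariant = λ { zero → inv ; (suc i) → invariant i }
    ; grows     = λ { {zero} _ →
                        subst (BarePathExt G k Q S) (≡-sym trees-0) (bare-extension (anchored y∈S))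
                    ; {suc i} (s≤s i<r) → grows i<r } }
    where
    np : NearestPath S
    np = nearestPath subtree (∣p∣≡1+r⇒Nonempty (Q ─ S) ∣Q─S∣≡1+r)
    open Extend subtree np
    open Growth (grow r (extend-invariant inv np) (suc-injective (trans (≡-sym count) ∣Q─S∣≡1+r)))

  initial : ∀ t {l} → ∣ Q ∣ ≡ suc l → Σ (Subset (n G)) λ S → Invariant t S × ∣ Q ─ S ∣ ≡ l
  initial t {l} ∣Q∣≡1+l with t ∈? Q
  ... | yes t∈Q = ⁅ t ⁆ , (IsSubtree-⁅⁆ t , x∈⁅x⁆ t , anchored ∘ x∈⁅y⁆⇒x≡y t) ,
    suc-injective (trans (≡-sym (x∈p⇒∣p∣≡1+∣p-x∣ t∈Q)) ∣Q∣≡1+l)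
    where
    anchored : ∀ {x} → x ≡ t → Anchored ⁅ t ⁆ x
    anchored refl = t , t∈Q , x∈⁅x⁆ t , 0 , [] , λ _ _ → z≤n
  ... | no t∉Q = S′ , (S′-subtree , S⊆S′ (x∈⁅x⁆ t) , path-anchored ∘ on-path) ,
    suc-injective (trans (≡-sym count) ∣Q-t∣≡1+l)
    where
    ∣Q-t∣≡1+l : ∣ Q - t ∣ ≡ suc l
    ∣Q-t∣≡1+l = trans (cong ∣_∣ (x∉p⇒p-x≡p t∉Q)) ∣Q∣≡1+l
    np : NearestPath ⁅ t ⁆
    np = nearestPath (IsSubtree-⁅⁆ t) (∣p∣≡1+r⇒Nonempty (Q - t) ∣Q-t∣≡1+l)
    open Extend (IsSubtree-⁅⁆ t) np
    on-path : ∀ {x} → x ∈ S′ → x ∈ₗ verts G path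
    on-path x∈S′ with ∈-∪ʷ⁻ path x∈S′
    ... | inj₁ x∈⁅t⁆ = subst (_∈ₗ verts G path)
                         (trans (x∈⁅y⁆⇒x≡y t y∈S) (≡-sym (x∈⁅y⁆⇒x≡y t x∈⁅t⁆))) (head∈verts path)
    ... | inj₂ x∈path = x∈path

lemma3p19 : (k l : ℕ) (T : Graph) → IsTree T → (t : V T) →
    (Q : Subset (n T)) → ∣ Q ∣ ≡ l → Separated T (2 * k) Q →
    Σ (Fin l → Subset (n T)) λ Ts →
      (∀ i → IsSubtree T (Ts i)) ×
      (∀ i → toℕ i ≡ 0 → t ∈ Ts i) ×
      (∀ i j → toℕ j ≡ suc (toℕ i) → BarePathExt T k Q (Ts i) (Ts j))
lemma3p19 k zero    T tree t Q _ _ = (λ ()) , (λ ()) , (λ ()) , λ ()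
lemma3p19 k (suc l) T tree t Q ∣Q∣≡1+l separated
  with Greedy.initial T tree k Q separated t ∣Q∣≡1+l
... | S , inv , ∣Q─S∣≡l =
  trees ∘ toℕ , proj₁ ∘ invariant ∘ toℕ , (λ i _ → proj₁ (proj₂ (invariant (toℕ i)))) , grows′
  where
  open Greedy T tree k Q separated
  open Growth (grow l inv ∣Q─S∣≡l)
  grows′ : ∀ i j → toℕ j ≡ suc (toℕ i) → BarePathExt T k Q (trees (toℕ i)) (trees (toℕ j))
  grows′ i j j≡1+i rewrite j≡1+i = grows (≤-pred (subst (_< suc l) j≡1+i (toℕ<n j)))
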